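{- Let $u=(u_1,u_2,\ldots)$ be a sequence of nonnegative integers that is eventually zero, let $w=\sum_i iu_i$, $d=\sum_i u_i$, and $\nu(u)=\sum_i u_i\,\nu(i+1)$. If $n$ is an integer with $w\le n$, then $n-\nu(u)\ge (n-d)/2$.
   Context: $\nu$ denotes the $2$-adic valuation of an integer. The sequence $u$ is regarded as a partition of $w$ in which $u_i$ is the multiplicity of the part $i$, and $d$ is the number of parts. -}

module Defs where

open import Data.Nat using (ℕ; zero; suc; _+_; _*_; _/_; _%_)
open import Data.List using (List; []; _∷_)

-- 2-adic valuation ν(m) of a positive integer m (with fuel m, which suffices
-- since 2^k ∣ m, m ≥ 1 implies k ≤ m).  Convention: ν 0 = 0 (never used).
ν-fuel : ℕ → ℕ → ℕ
ν-fuel zero    m = 0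
ν-fuel (suc f) zero = 0
ν-fuel (suc f) (suc m) with suc m % 2
... | zero  = suc (ν-fuel f (suc m / 2))
... | suc _ = 0

ν : ℕ → ℕ
ν m = ν-fuel m m

-- A finitely supported sequence u = (u_1, u_2, ...) is given by the list
-- [u_1, ..., u_k] (all later entries are 0).
-- Helpers with explicit starting index i (the first list entry is u_i).
weightFrom : ℕ → List ℕ → ℕ
weightFrom i []       = 0
weightFrom i (x ∷ xs) = i * x + weightFrom (suc i) xs

νFrom : ℕ → List ℕ → ℕ
νFrom i []       = 0
νFrom i (x ∷ xs) = x * ν (suc i) + νFrom (suc i) xs

weight : List ℕ → ℕ
weight u = weightFrom 1 u

parts : List ℕ → ℕ
parts []       = 0
parts (x ∷ xs) = x + parts xs

νseq : List ℕ → ℕ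
νseq u = νFrom 1 u

-- Since 2^ν(m) divides m, 2 ν(m) ≤ 2^ν(m) ≤ m; so each part i of u contributes
-- u_i ν(i+1) ≤ u_i (i+1)/2 to ν(u), giving 2 ν(u) ≤ w + d ≤ n + d, which is the
-- claimed inequality after clearing denominators.
module Submission where

open import Defs
open import Data.List using (List; []; _∷_)
open import Data.Integer using (ℤ; +_; _-_; _≤_)
open import Data.Rational using (ℚ; _/_; _≥_)
open import Data.Nat as ℕ using (ℕ; zero; suc; z≤n; s≤s)
import Data.Nat.Properties as ℕ
open import Data.Nat.DivMod using (m≡m%n+[m/n]*n; m/n<m; m/n*n≤m)
import Data.Nat.Tactic.RingSolver as ℕ-Solver
import Data.Integer as ℤ
import Data.Integer.Properties as ℤ
import Data.Integer.Tactic.RingSolver as ℤ-Solver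
import Data.Rational as ℚ
import Data.Rational.Properties as ℚ
import Data.Rational.Unnormalised as ℚᵘ
import Data.Rational.Unnormalised.Properties as ℚᵘ
open import Relation.Binary.PropositionalEquality using (_≡_; trans; cong)

<-of-≤-half : ∀ {x m} k → suc m ≡ k ℕ.* 2 → x ℕ.≤ k ℕ./ 2 → x ℕ.< k
<-of-≤-half zero    ()
<-of-≤-half (suc k) _ x≤k/2 = ℕ.≤-<-trans x≤k/2 (m/n<m (suc k) 2 (s≤s (s≤s z≤n)))

ν-fuel≤half : ∀ f m → ν-fuel f m ℕ.≤ m ℕ./ 2
ν-fuel≤half zero    m       = z≤n
ν-fuel≤half (suc f) zero    = z≤n
ν-fuel≤half (suc f) (suc m) with suc m ℕ.% 2 in m%2≡0
... | suc _ = z≤n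
... | zero  = <-of-≤-half (suc m ℕ./ 2) m≡half*2 (ν-fuel≤half f (suc m ℕ./ 2))
  where
  m≡half*2 : suc m ≡ suc m ℕ./ 2 ℕ.* 2
  m≡half*2 = trans (m≡m%n+[m/n]*n (suc m) 2) (cong (ℕ._+ suc m ℕ./ 2 ℕ.* 2) m%2≡0)

double-ν≤ : ∀ m → 2 ℕ.* ν m ℕ.≤ m
double-ν≤ m = begin
  2 ℕ.* ν m          ≤⟨ ℕ.*-monoʳ-≤ 2 (ν-fuel≤half m m) ⟩
  2 ℕ.* (m ℕ./ 2)    ≡⟨ ℕ.*-comm 2 (m ℕ./ 2) ⟩
  m ℕ./ 2 ℕ.* 2      ≤⟨ m/n*n≤m m 2 ⟩
  m                  ∎
  where open ℕ.≤-Reasoning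

double-νFrom≤weightFrom+parts : ∀ i u → 2 ℕ.* νFrom i u ℕ.≤ weightFrom i u ℕ.+ parts u
double-νFrom≤weightFrom+parts i []       = z≤n
double-νFrom≤weightFrom+parts i (x ∷ xs) = begin
  2 ℕ.* (x ℕ.* ν (suc i) ℕ.+ νFrom (suc i) xs)
    ≡⟨ distribute x (ν (suc i)) (νFrom (suc i) xs) ⟩
  x ℕ.* (2 ℕ.* ν (suc i)) ℕ.+ 2 ℕ.* νFrom (suc i) xs
    ≤⟨ ℕ.+-mono-≤ (ℕ.*-monoʳ-≤ x (double-ν≤ (suc i)))
                  (double-νFrom≤weightFrom+parts (suc i) xs) ⟩
  x ℕ.* suc i ℕ.+ (weightFrom (suc i) xs ℕ.+ parts xs)
    ≡⟨ regroup i x (weightFrom (suc i) xs) (parts xs) ⟩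
  i ℕ.* x ℕ.+ weightFrom (suc i) xs ℕ.+ (x ℕ.+ parts xs)
    ∎
  where
  open ℕ.≤-Reasoning
  distribute : ∀ x a r → 2 ℕ.* (x ℕ.* a ℕ.+ r) ≡ x ℕ.* (2 ℕ.* a) ℕ.+ 2 ℕ.* r
  distribute = ℕ-Solver.solve-∀
  regroup : ∀ i x w p → x ℕ.* suc i ℕ.+ (w ℕ.+ p) ≡ i ℕ.* x ℕ.+ w ℕ.+ (x ℕ.+ p)
  regroup = ℕ-Solver.solve-∀

double-νseq≤weight+parts : ∀ u → 2 ℕ.* νseq u ℕ.≤ weight u ℕ.+ parts u
double-νseq≤weight+parts = double-νFrom≤weightFrom+parts 1

/-mono-≤-cross : ∀ p q {c d} → p ℤ.* + suc d ≤ q ℤ.* + suc c → p / suc c ℚ.≤ q / suc d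
/-mono-≤-cross p q {c} {d} pd≤qc = ℚ.toℚᵘ-cancel-≤
  (ℚᵘ.≤-respˡ-≃ (ℚᵘ.≃-sym (ℚ.toℚᵘ-fromℚᵘ (ℚᵘ.mkℚᵘ p c)))
  (ℚᵘ.≤-respʳ-≃ (ℚᵘ.≃-sym (ℚ.toℚᵘ-fromℚᵘ (ℚᵘ.mkℚᵘ q d)))
  (ℚᵘ.*≤* pd≤qc)))

halves-≤ : ∀ n d v → + 2 ℤ.* v ≤ n ℤ.+ d → (n - d) ℤ.* + 1 ≤ (n - v) ℤ.* + 2
halves-≤ n d v 2v≤n+d = ℤ.0≤i-j⇒j≤i (ℤ.≤-trans (ℤ.i≤j⇒0≤j-i 2v≤n+d) (ℤ.≤-reflexive (gap n d v)))
  where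
  gap : ∀ n d v → n ℤ.+ d - + 2 ℤ.* v ≡ (n - v) ℤ.* + 2 - (n - d) ℤ.* + 1
  gap = ℤ-Solver.solve-∀

corollary6p1 : (u : List ℕ) (n : ℤ) → + weight u ≤ n →
    ((n - + νseq u) / 1) ≥ ((n - + parts u) / 2)
corollary6p1 u n w≤n =
  /-mono-≤-cross (n - + parts u) (n - + νseq u) (halves-≤ n (+ parts u) (+ νseq u) 2ν≤n+d)
  where
  open ℤ.≤-Reasoning
  2ν≤n+d : + 2 ℤ.* + νseq u ≤ n ℤ.+ + parts u
  2ν≤n+d = begin
    + 2 ℤ.* + νseq u         ≡⟨ ℤ.pos-* 2 (νseq u) ⟨
    + (2 ℕ.* νseq u)         ≤⟨ ℤ.+≤+ (double-νseq≤weight+parts u) ⟩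
    + weight u ℤ.+ + parts u ≤⟨ ℤ.+-monoˡ-≤ (+ parts u) w≤n ⟩
    n ℤ.+ + parts u          ∎
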